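{- In the setting described in the context, let $w\in V$ and let $U\subseteq V\setminus\{r_0\}$ with $R\cap U\ne\emptyset$. Let $j=\min\{i: r_i\in U\}$, let $(r_i,r_j)\in A$ be the arc of $A$ entering $r_j$, and let $P=\{r_i,r_j\}$. Then $\overline x^w(\delta^+(U))\ge z^w_P$.
   Context: A Steiner Forest instance $(G,c,\mathcal{P})$: undirected graph $G=(V,E)$, costs $c:E\to\mathbb{R}_{\ge0}$, collection $\mathcal{P}$ of pairs $\{s,t\}\subseteq V$. The demand graph has vertex set $V$ and edge $\{s,t\}$ iff $\{s,t\}\in\mathcal{P}$; assume it has exactly one nontrivial (more than one vertex) connected component, with vertex set $R$. $\overrightarrow{E}$ replaces each $\{u,v\}\in E$ by $(u,v),(v,u)$; $\delta^\pm(U)$ are the directed edges leaving/entering $U$, and $y(D)=\sum_{e\in D}y_e$. Forest-BCR: variables $x^r_e$, $z^r_P$; constraints $\sum_r z^r_P=1$ for all $P$; $\sum_{e\in\delta^+(U)}x^r_e\ge z^r_P$ for all $r\in V$, $P$, $U\subseteq V\setminus\{r\}$ with $P\cap U\ne\emptyset$; $x,z\ge0$. Let $(x,z)$ be feasible. Fix $r_0\in R$, a spanning tree of the nontrivial component oriented away from $r_0$ as an arborescence $(R,A)$, and number $R$ as $r_0,\dots,r_{|R|-1}$ with $i<j$ for each arc $(r_i,r_j)\in A$. For each $w\in V$, let $\lambda_i=\max\{z^w_P:P\cap\{r_0,\dots,r_i\}\ne\emptyset\}$, $\mu_0=\lambda_0$, $\mu_i=\lambda_i-\lambda_{i-1}$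 ($i\ge1$), let $f=f^w\in\mathbb{R}^{\overrightarrow{E}}_{\ge0}$ satisfy $f(\delta^+(r_i))-f(\delta^-(r_i))=\mu_i$ for $r_i\in R\setminus\{w\}$, $f(\delta^+(v))-f(\delta^-(v))=0$ for $v\in V\setminus(R\cup\{w\})$, and $f_e\le x^w_e$ for all $e$ (such $f$ exists), and set $\overline x^w_{(u,v)}=x^w_{(u,v)}-f_{(u,v)}+f_{(v,u)}$ for $(u,v)\in\overrightarrow{E}$.
   Formalization: The costs c, the feasible Forest-BCR solution (x,z) and the flow f take values in ℚ rather than ℝ. -}

module Defs where

open import Data.Nat using (ℕ; zero; suc)
open import Data.Fin using (Fin; zero; suc; toℕ)
open import Data.Bool using (Bool; true; false; not; if_then_else_; _∧_; _∨_)
open import Data.Product using (_×_; _,_; proj₁; proj₂)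
open import Data.Rational using (ℚ; 0ℚ; _+_; _-_; _⊔_)
open import Relation.Nullary.Decidable using (⌊_⌋)
open import Data.Fin.Properties using (_≟_)
open import Data.Nat using (_≤ᵇ_)

sumFin : ∀ {k} → (Fin k → ℚ) → ℚ
sumFin {zero}  g = 0ℚ
sumFin {suc k} g = g zero + sumFin (λ i → g (suc i))

-- Finite max over Fin k restricted to a Boolean filter (0 if empty; only
-- used on nonempty sets of nonnegative numbers).
maxFin : ∀ {k} → (Fin k → Bool) → (Fin k → ℚ) → ℚ
maxFin {zero}  b g = 0ℚ
maxFin {suc k} b g =
  (if b zero then g zero else 0ℚ) ⊔ maxFin (λ i → b (suc i)) (λ i → g (suc i))

anyFin : ∀ {k} → (Fin k → Bool) → Bool
anyFin {zero}  b = false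
anyFin {suc k} b = b zero ∨ anyFin (λ i → b (suc i))

_==_ : ∀ {n} → Fin n → Fin n → Bool
u == v = ⌊ u ≟ v ⌋

-- Undirected graph with vertex set Fin n and edges Fin m, edge e joins
-- proj₁ (E e) and proj₂ (E e).  Directed version: each edge e yields the
-- arcs (e , true) = (proj₁ (E e), proj₂ (E e)) and (e , false) = reverse.
Arc : ℕ → Set
Arc m = Fin m × Bool

tail : ∀ {n m} → (Fin m → Fin n × Fin n) → Arc m → Fin n
tail E (e , true)  = proj₁ (E e)
tail E (e , false) = proj₂ (E e)

head : ∀ {n m} → (Fin m → Fin n × Fin n) → Arc m → Fin n
head E (e , true)  = proj₂ (E e)
head E (e , false) = proj₁ (E e)

rev : ∀ {m} → Arc m → Arc m
rev (e , b) = (e , not b)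

sumArcs : ∀ {m} → (Arc m → Bool) → (Arc m → ℚ) → ℚ
sumArcs D y = sumFin (λ e → (if D (e , true) then y (e , true) else 0ℚ)
                          + (if D (e , false) then y (e , false) else 0ℚ))

Subset : ℕ → Set
Subset n = Fin n → Bool

δ⁺ : ∀ {n m} → (Fin m → Fin n × Fin n) → Subset n → Arc m → Bool
δ⁺ E U a = U (tail E a) ∧ not (U (head E a))

δ⁻ : ∀ {n m} → (Fin m → Fin n × Fin n) → Subset n → Arc m → Bool
δ⁻ E U a = not (U (tail E a)) ∧ U (head E a)

⟦_⟧ : ∀ {n} → Fin n → Subset n
⟦ v ⟧ u = u == v

outSum : ∀ {n m} → (Fin m → Fin n × Fin n) → Subset n → (Arc m → ℚ) → ℚ
outSum E U y = sumArcs (δ⁺ E U) y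

inSum : ∀ {n m} → (Fin m → Fin n × Fin n) → Subset n → (Arc m → ℚ) → ℚ
inSum E U y = sumArcs (δ⁻ E U) y

meets : ∀ {n} → Fin n × Fin n → Subset n → Bool
meets P U = U (proj₁ P) ∨ U (proj₂ P)

prefixSet : ∀ {n s} → (Fin s → Fin n) → Fin s → Subset n
prefixSet r i v = anyFin (λ l → (toℕ l ≤ᵇ toℕ i) ∧ (r l == v))

lam : ∀ {n p s} → (Fin p → Fin n × Fin n) → (Fin p → Fin n → ℚ) →
      (Fin s → Fin n) → Fin n → Fin s → ℚ
lam 𝒫 z r w i = maxFin (λ k → meets (𝒫 k) (prefixSet r i)) (λ k → z k w)

mu : ∀ {n p s} → (Fin p → Fin n × Fin n) → (Fin p → Fin n → ℚ) →
     (Fin (suc s) → Fin n) → Fin n → Fin (suc s) → ℚ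
mu 𝒫 z r w zero    = lam 𝒫 z r w zero
mu 𝒫 z r w (suc i) = lam 𝒫 z r w (suc i) - lam 𝒫 z r w (Data.Fin.inject₁ i)

xbar : ∀ {m} → (Arc m → ℚ) → (Arc m → ℚ) → Arc m → ℚ
xbar xw f a = xw a - f a + f (rev a)

-- Write X = x^w(δ⁺(U)). Since x̄^w = x^w − f + f ∘ rev, x̄^w(δ⁺(U)) = X − (net outflow of f from U), and
-- by flow conservation the net outflow of f from a set S with w ∉ S is Σ_{r_i ∈ S} μ_i, a selection of the
-- increments of the nondecreasing sequence λ. Write j for the first index with r_j ∈ U; the parent of r_j
-- is some r_i with i ≤ j − 1, so z^w_P ≤ λ_{j−1}.
--
-- If w ∈ U, take S = V ∖ U: then x̄^w(δ⁺(U)) = X + Σ_{r_i ∉ U} μ_i ≥ μ_0 + ⋯ + μ_{j−1} = λ_{j−1}.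
--
-- If w ∉ U, feasibility gives z^w_Q ≤ X for every pair Q meeting U, hence λ_i ≤ max(λ_{i−1}, X) whenever
-- r_i ∈ U. On such a step μ_i is also the increment of min(λ, X), and since all these steps come after j − 1
-- they add up to at most X − min(λ_{j−1}, X). So x̄^w(δ⁺(U)) ≥ min(λ_{j−1}, X) ≥ z^w_P, the last bound
-- because P meets U.

module Submission where

open import Algebra.Bundles using (CommutativeRing)
open import Data.Bool using (Bool; true; false; not; _∧_; _∨_; if_then_else_)
open import Data.Bool.Properties using (¬-not; not-involutive; ∨-zeroʳ; T-≡)
open import Data.Fin using (Fin; zero; suc; punchIn; inject₁; toℕ)
open import Data.Fin.Properties using (_≟_; any?; punchInᵢ≢i; toℕ-inject₁; toℕ-injective)
open import Data.Nat using (ℕ; zero; suc; z≤n; s≤s)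
open import Data.Nat as N using ()
import Data.Nat.Properties as NP
open import Data.Product using (_×_; _,_; proj₁; proj₂; ∃)
open import Data.Rational using (ℚ; 0ℚ; 1ℚ; _+_; _*_; _-_; -_; _≤_; _⊓_; _⊔_)
open import Data.Rational.Properties hiding (_≟_)
open import Data.Rational.Solver using (module +-*-Solver)
open import Data.Sum using (_⊎_; inj₁; inj₂)
open import Defs
open import Function using (_∘_; Equivalence)
open import Relation.Binary.PropositionalEquality
open import Relation.Nullary.Decidable using (isYes≗does; dec-true; dec-false; yes; no)

open import Algebra.Properties.Semiring.Sum (CommutativeRing.semiring +-*-commutativeRing)
open import Algebra.Properties.AbelianGroup +-0-abelianGroup using (⁻¹-anti-homo‿-)
open +-*-Solver using (solve; _:+_; _:-_; _:*_; _:=_; con)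

𝟙 : Bool → ℚ
𝟙 true  = 1ℚ
𝟙 false = 0ℚ

𝟙-true : ∀ {b} y → b ≡ true → 𝟙 b * y ≡ y
𝟙-true y refl = *-identityˡ y

𝟙-false : ∀ {b} y → b ≡ false → 𝟙 b * y ≡ 0ℚ
𝟙-false y refl = *-zeroˡ y

𝟙*-nonneg : ∀ b {y} → 0ℚ ≤ y → 0ℚ ≤ 𝟙 b * y
𝟙*-nonneg true  {y} y≥0 = subst (0ℚ ≤_) (sym (*-identityˡ y)) y≥0
𝟙*-nonneg false {y} _   = ≤-reflexive (sym (*-zeroˡ y))

==-true : ∀ {n} {u v : Fin n} → u ≡ v → (u == v) ≡ true
==-true {u = u} {v} u≡v = trans (isYes≗does (u ≟ v)) (dec-true (u ≟ v) u≡v)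

==-false : ∀ {n} {u v : Fin n} → u ≢ v → (u == v) ≡ false
==-false {u = u} {v} u≢v = trans (isYes≗does (u ≟ v)) (dec-false (u ≟ v) u≢v)

==-sound : ∀ {n} {u v : Fin n} → (u == v) ≡ true → u ≡ v
==-sound {u = u} {v} eq with u ≟ v
==-sound eq | yes u≡v = u≡v
==-sound () | no _

p+q≤r⇒p≤r-q : ∀ {p q r} → p + q ≤ r → p ≤ r - q
p+q≤r⇒p≤r-q {p} {q} {r} p+q≤r = begin
  p          ≡⟨ solve 2 (λ p q → p := p :+ q :- q) refl p q ⟩
  p + q - q  ≤⟨ +-monoˡ-≤ (- q) p+q≤r ⟩
  r - q      ∎
  where open ≤-Reasoning

0≤p⇒q≤p+q : ∀ {p} q → 0ℚ ≤ p → q ≤ p + q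
0≤p⇒q≤p+q {p} q p≥0 = subst (_≤ p + q) (+-identityˡ q) (+-monoˡ-≤ q p≥0)

⊓-step : ∀ {a b X} → a ≤ b → b ≤ a ⊔ X → (a ⊓ X) + (b - a) ≡ b ⊓ X
⊓-step {a} {b} {X} a≤b b≤a⊔X with ≤-total a X
... | inj₁ a≤X = begin
  (a ⊓ X) + (b - a)  ≡⟨ cong (_+ (b - a)) (p≤q⇒p⊓q≡p a≤X) ⟩
  a + (b - a)        ≡⟨ solve 2 (λ a b → a :+ (b :- a) := b) refl a b ⟩
  b                  ≡⟨ p≤q⇒p⊓q≡p (subst (b ≤_) (p≤q⇒p⊔q≡q a≤X) b≤a⊔X) ⟨
  b ⊓ X              ∎
  where open ≡-Reasoning
... | inj₂ X≤a = begin
  (a ⊓ X) + (b - a)  ≡⟨ cong₂ _+_ (p≥q⇒p⊓q≡q X≤a) (trans (cong (_- a) b≡a) (+-inverseʳ a)) ⟩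
  X + 0ℚ             ≡⟨ +-identityʳ X ⟩
  X                  ≡⟨ p≥q⇒p⊓q≡q (≤-trans X≤a a≤b) ⟨
  b ⊓ X              ∎
  where
  open ≡-Reasoning
  b≡a : b ≡ a
  b≡a = ≤-antisym (subst (b ≤_) (p≥q⇒p⊔q≡p X≤a) b≤a⊔X) a≤b

<-suc⇒≤-inject₁ : ∀ {n} {i : Fin (suc n)} (j : Fin n) → toℕ i N.< toℕ (suc j) → toℕ i N.≤ toℕ (inject₁ j)
<-suc⇒≤-inject₁ j (s≤s i≤j) = NP.≤-trans i≤j (NP.≤-reflexive (sym (toℕ-inject₁ j)))

≤-inject₁⇒<-suc : ∀ {n} {i : Fin (suc n)} (j : Fin n) → toℕ i N.≤ toℕ (inject₁ j) → toℕ i N.< toℕ (suc j)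
≤-inject₁⇒<-suc j i≤j = s≤s (NP.≤-trans i≤j (NP.≤-reflexive (toℕ-inject₁ j)))

sumFin≡sum : ∀ {k} (g : Fin k → ℚ) → sumFin g ≡ sum g
sumFin≡sum {zero}  g = refl
sumFin≡sum {suc k} g = cong (g zero +_) (sumFin≡sum (g ∘ suc))

∑-neg : ∀ {k} (g : Fin k → ℚ) → ∑[ i < k ] (- g i) ≡ - sum g
∑-neg {zero}  g = refl
∑-neg {suc k} g = trans (cong (- g zero +_) (∑-neg (g ∘ suc))) (sym (neg-distrib-+ (g zero) _))

∑-distrib-- : ∀ {k} (g h : Fin k → ℚ) → ∑[ i < k ] (g i - h i) ≡ sum g - sum h
∑-distrib-- g h = trans (∑-distrib-+ g (λ i → - h i)) (cong (sum g +_) (∑-neg h))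

sum-nonneg : ∀ {k} {g : Fin k → ℚ} → (∀ i → 0ℚ ≤ g i) → 0ℚ ≤ sum g
sum-nonneg {zero}  g≥0 = ≤-refl
sum-nonneg {suc k} g≥0 = +-mono-≤ (g≥0 zero) (sum-nonneg (g≥0 ∘ suc))

sum-pick : ∀ {k} (b : Fin k → Bool) (a : Fin k) (h : Fin k → ℚ) →
           b a ≡ true → (∀ i → b i ≡ true → i ≡ a) →
           ∑[ i < k ] (𝟙 (b i) * h i) ≡ h a
sum-pick {suc k} b a h ba unique = begin
  ∑[ i < suc k ] (𝟙 (b i) * h i)                        ≡⟨ sum-remove {i = a} (λ i → 𝟙 (b i) * h i) ⟩
  𝟙 (b a) * h a + ∑[ j < k ] (𝟙 (b (punchIn a j)) * h (punchIn a j))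
                                                        ≡⟨ cong₂ _+_ (cong (λ c → 𝟙 c * h a) ba) (sum-cong-≗ others) ⟩
  1ℚ * h a + sum {k} (λ _ → 0ℚ)                        ≡⟨ cong₂ _+_ (*-identityˡ (h a)) (sum-replicate-zero k) ⟩
  h a + 0ℚ                                             ≡⟨ +-identityʳ (h a) ⟩
  h a                                                  ∎
  where
  open ≡-Reasoning
  others : ∀ j → 𝟙 (b (punchIn a j)) * h (punchIn a j) ≡ 0ℚ
  others j = 𝟙-false _ (¬-not (punchInᵢ≢i a j ∘ unique (punchIn a j)))

sum-at : ∀ {k} (a : Fin k) (h : Fin k → ℚ) → ∑[ v < k ] (𝟙 (a == v) * h v) ≡ h a
sum-at a h = sum-pick (a ==_) a h (==-true refl) (λ v a==v → sym (==-sound a==v))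

∑-over-image : ∀ {s n} (r : Fin s → Fin n) → (∀ i l → r i ≡ r l → i ≡ l) →
               (h : Fin n → ℚ) → (∀ v → (∀ i → r i ≢ v) → h v ≡ 0ℚ) →
               sum h ≡ ∑[ i < s ] h (r i)
∑-over-image {s} {n} r r-injective h h-support = begin
  sum h                                    ≡⟨ sum-cong-≗ split ⟩
  ∑[ v < n ] ∑[ i < s ] (𝟙 (r i == v) * h v) ≡⟨ ∑-comm (λ v i → 𝟙 (r i == v) * h v) ⟩
  ∑[ i < s ] ∑[ v < n ] (𝟙 (r i == v) * h v) ≡⟨ sum-cong-≗ (λ i → sum-at (r i) h) ⟩
  ∑[ i < s ] h (r i)                       ∎
  where
  open ≡-Reasoning
  split : ∀ v → h v ≡ ∑[ i < s ] (𝟙 (r i == v) * h v)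
  split v with any? (λ i → r i ≟ v)
  ... | yes (i , refl) = sym (sum-pick (λ l → r l == r i) i (λ _ → h (r i)) (==-true refl)
                                       (λ l rl==ri → r-injective l i (==-sound rl==ri)))
  ... | no ∄i = begin
    h v                              ≡⟨ h-support v (λ i → ∄i ∘ (i ,_)) ⟩
    0ℚ                               ≡⟨ sum-replicate-zero s ⟨
    sum {s} (λ _ → 0ℚ)               ≡⟨ sum-cong-≗ (λ i → 𝟙-false (h v) (==-false (∄i ∘ (i ,_)))) ⟨
    ∑[ i < s ] (𝟙 (r i == v) * h v)  ∎

arcTerms : ∀ {m} → (Arc m → Bool) → (Arc m → ℚ) → Fin m → ℚ
arcTerms D y e = (if D (e , true) then y (e , true) else 0ℚ) + (if D (e , false) then y (e , false) else 0ℚ)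

netOutflow : ∀ {n m} → (Fin m → Fin n × Fin n) → Subset n → (Arc m → ℚ) → ℚ
netOutflow E U y = outSum E U y - inSum E U y

edgeOutflow : ∀ {n m} → (Fin m → Fin n × Fin n) → Subset n → (Arc m → ℚ) → Fin m → ℚ
edgeOutflow E U y e = (𝟙 (U (proj₁ (E e))) - 𝟙 (U (proj₂ (E e)))) * (y (e , true) - y (e , false))

netOutflow-edge : ∀ p q (yt yf : ℚ) →
  (if p ∧ not q then yt else 0ℚ) + (if q ∧ not p then yf else 0ℚ)
    - ((if not p ∧ q then yt else 0ℚ) + (if not q ∧ p then yf else 0ℚ))
  ≡ (𝟙 p - 𝟙 q) * (yt - yf)
netOutflow-edge true  true  = solve 2 (λ yt yf → con 0ℚ := (con 1ℚ :- con 1ℚ) :* (yt :- yf)) refl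
netOutflow-edge true  false = solve 2 (λ yt yf →
  yt :+ con 0ℚ :- (con 0ℚ :+ yf) := (con 1ℚ :- con 0ℚ) :* (yt :- yf)) refl
netOutflow-edge false true  = solve 2 (λ yt yf →
  con 0ℚ :+ yf :- (yt :+ con 0ℚ) := (con 0ℚ :- con 1ℚ) :* (yt :- yf)) refl
netOutflow-edge false false = solve 2 (λ yt yf → con 0ℚ := (con 0ℚ :- con 0ℚ) :* (yt :- yf)) refl

netOutflow-incidence : ∀ {n m} (E : Fin m → Fin n × Fin n) (U : Subset n) (y : Arc m → ℚ) →
                       netOutflow E U y ≡ ∑[ e < m ] edgeOutflow E U y e
netOutflow-incidence {m = m} E U y = begin
  outSum E U y - inSum E U y           ≡⟨ cong₂ _-_ (sumFin≡sum out) (sumFin≡sum in′) ⟩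
  sum out - sum in′                    ≡⟨ ∑-distrib-- out in′ ⟨
  ∑[ e < m ] (out e - in′ e)           ≡⟨ sum-cong-≗ across ⟩
  ∑[ e < m ] edgeOutflow E U y e       ∎
  where
  open ≡-Reasoning
  out = arcTerms (δ⁺ E U) y
  in′ = arcTerms (δ⁻ E U) y
  across : ∀ e → out e - in′ e ≡ edgeOutflow E U y e
  across e = netOutflow-edge (U (proj₁ (E e))) (U (proj₂ (E e))) (y (e , true)) (y (e , false))

edgeOutflow-decompose : ∀ {n m} (E : Fin m → Fin n × Fin n) (U : Subset n) (y : Arc m → ℚ) (e : Fin m) →
                        ∑[ v < n ] (𝟙 (U v) * edgeOutflow E ⟦ v ⟧ y e) ≡ edgeOutflow E U y e
edgeOutflow-decompose {n} E U y e = begin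
  ∑[ v < n ] (𝟙 (U v) * ((𝟙 (a == v) - 𝟙 (b == v)) * φ))  ≡⟨ sum-cong-≗ regroup ⟩
  ∑[ v < n ] ((χa v - χb v) * φ)                         ≡⟨ *-distribʳ-sum φ (λ v → χa v - χb v) ⟨
  (∑[ v < n ] (χa v - χb v)) * φ                         ≡⟨ cong (_* φ) (∑-distrib-- χa χb) ⟩
  (sum χa - sum χb) * φ                                  ≡⟨ cong (_* φ) (cong₂ _-_ (sum-at a (𝟙 ∘ U)) (sum-at b (𝟙 ∘ U))) ⟩
  (𝟙 (U a) - 𝟙 (U b)) * φ                                ∎
  where
  open ≡-Reasoning
  a = proj₁ (E e)
  b = proj₂ (E e)
  φ = y (e , true) - y (e , false)
  χa χb : Fin n → ℚ
  χa v = 𝟙 (a == v) * 𝟙 (U v)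
  χb v = 𝟙 (b == v) * 𝟙 (U v)
  regroup : ∀ v → 𝟙 (U v) * ((𝟙 (a == v) - 𝟙 (b == v)) * φ) ≡ (χa v - χb v) * φ
  regroup v = solve 4 (λ u p q φ → u :* ((p :- q) :* φ) := (p :* u :- q :* u) :* φ) refl
                      (𝟙 (U v)) (𝟙 (a == v)) (𝟙 (b == v)) φ

netOutflow-decompose : ∀ {n m} (E : Fin m → Fin n × Fin n) (U : Subset n) (y : Arc m → ℚ) →
                       netOutflow E U y ≡ ∑[ v < n ] (𝟙 (U v) * netOutflow E ⟦ v ⟧ y)
netOutflow-decompose {n} {m} E U y = begin
  netOutflow E U y                                          ≡⟨ netOutflow-incidence E U y ⟩
  ∑[ e < m ] edgeOutflow E U y e                            ≡⟨ sum-cong-≗ (edgeOutflow-decompose E U y) ⟨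
  ∑[ e < m ] ∑[ v < n ] (𝟙 (U v) * edgeOutflow E ⟦ v ⟧ y e)  ≡⟨ ∑-comm (λ v e → 𝟙 (U v) * edgeOutflow E ⟦ v ⟧ y e) ⟨
  ∑[ v < n ] ∑[ e < m ] (𝟙 (U v) * edgeOutflow E ⟦ v ⟧ y e)  ≡⟨ sum-cong-≗ (λ v → *-distribˡ-sum (𝟙 (U v)) (edgeOutflow E ⟦ v ⟧ y)) ⟨
  ∑[ v < n ] (𝟙 (U v) * ∑[ e < m ] edgeOutflow E ⟦ v ⟧ y e)  ≡⟨ sum-cong-≗ (λ v → cong (𝟙 (U v) *_) (netOutflow-incidence E ⟦ v ⟧ y)) ⟨
  ∑[ v < n ] (𝟙 (U v) * netOutflow E ⟦ v ⟧ y)               ∎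
  where open ≡-Reasoning

outSum-xbar-edge : ∀ p q (xt xf ft ff : ℚ) →
  (if p ∧ not q then xt - ft + ff else 0ℚ) + (if q ∧ not p then xf - ff + ft else 0ℚ)
  ≡ (if p ∧ not q then xt else 0ℚ) + (if q ∧ not p then xf else 0ℚ) - (𝟙 p - 𝟙 q) * (ft - ff)
outSum-xbar-edge true  true  = solve 4 (λ xt xf ft ff → con 0ℚ := con 0ℚ :- (con 1ℚ :- con 1ℚ) :* (ft :- ff)) refl
outSum-xbar-edge true  false = solve 4 (λ xt xf ft ff →
  xt :- ft :+ ff :+ con 0ℚ := xt :+ con 0ℚ :- (con 1ℚ :- con 0ℚ) :* (ft :- ff)) refl
outSum-xbar-edge false true  = solve 4 (λ xt xf ft ff →
  con 0ℚ :+ (xf :- ff :+ ft) := con 0ℚ :+ xf :- (con 0ℚ :- con 1ℚ) :* (ft :- ff)) refl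
outSum-xbar-edge false false = solve 4 (λ xt xf ft ff → con 0ℚ := con 0ℚ :- (con 0ℚ :- con 0ℚ) :* (ft :- ff)) refl

outSum-xbar : ∀ {n m} (E : Fin m → Fin n × Fin n) (U : Subset n) (xw f : Arc m → ℚ) →
              outSum E U (xbar xw f) ≡ outSum E U xw - netOutflow E U f
outSum-xbar {m = m} E U xw f = begin
  outSum E U (xbar xw f)                                ≡⟨ sumFin≡sum out-xbar ⟩
  sum out-xbar                                          ≡⟨ sum-cong-≗ per-edge ⟩
  ∑[ e < m ] (out e - edgeOutflow E U f e)              ≡⟨ ∑-distrib-- out (edgeOutflow E U f) ⟩
  sum out - ∑[ e < m ] edgeOutflow E U f e              ≡⟨ cong₂ _-_ (sumFin≡sum out) (netOutflow-incidence E U f) ⟨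
  outSum E U xw - netOutflow E U f                      ∎
  where
  open ≡-Reasoning
  out = arcTerms (δ⁺ E U) xw
  out-xbar = arcTerms (δ⁺ E U) (xbar xw f)
  per-edge : ∀ e → out-xbar e ≡ out e - edgeOutflow E U f e
  per-edge e = outSum-xbar-edge (U (proj₁ (E e))) (U (proj₂ (E e)))
                                (xw (e , true)) (xw (e , false)) (f (e , true)) (f (e , false))

sumArcs-cong : ∀ {m} {D D′ : Arc m → Bool} → (∀ a → D a ≡ D′ a) → (y : Arc m → ℚ) →
               sumArcs D y ≡ sumArcs D′ y
sumArcs-cong {D = D} {D′} D≗D′ y = begin
  sumArcs D y          ≡⟨ sumFin≡sum (arcTerms D y) ⟩
  sum (arcTerms D y)   ≡⟨ sum-cong-≗ (λ e → cong₂ _+_ (same-if (e , true)) (same-if (e , false))) ⟩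
  sum (arcTerms D′ y)  ≡⟨ sumFin≡sum (arcTerms D′ y) ⟨
  sumArcs D′ y         ∎
  where
  open ≡-Reasoning
  same-if : ∀ a → (if D a then y a else 0ℚ) ≡ (if D′ a then y a else 0ℚ)
  same-if a = cong (λ b → if b then y a else 0ℚ) (D≗D′ a)

sumArcs-nonneg : ∀ {m} (D : Arc m → Bool) {y : Arc m → ℚ} → (∀ a → 0ℚ ≤ y a) → 0ℚ ≤ sumArcs D y
sumArcs-nonneg D {y} y≥0 = subst (0ℚ ≤_) (sym (sumFin≡sum (arcTerms D y)))
  (sum-nonneg (λ e → +-mono-≤ (if-nonneg (D (e , true))) (if-nonneg (D (e , false)))))
  where
  if-nonneg : ∀ {a} b → 0ℚ ≤ (if b then y a else 0ℚ)
  if-nonneg true  = y≥0 _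
  if-nonneg false = ≤-refl

netOutflow-complement : ∀ {n m} (E : Fin m → Fin n × Fin n) (U : Subset n) (y : Arc m → ℚ) →
                        netOutflow E (not ∘ U) y ≡ - netOutflow E U y
netOutflow-complement E U y = begin
  outSum E (not ∘ U) y - inSum E (not ∘ U) y ≡⟨ cong₂ _-_ (sumArcs-cong δ⁺-complement y)
                                                           (sumArcs-cong δ⁻-complement y) ⟩
  inSum E U y - outSum E U y                 ≡⟨ ⁻¹-anti-homo‿- (outSum E U y) (inSum E U y) ⟨
  - netOutflow E U y                         ∎
  where
  open ≡-Reasoning
  δ⁺-complement : ∀ a → δ⁺ E (not ∘ U) a ≡ δ⁻ E U a
  δ⁺-complement a = cong (not (U (tail E a)) ∧_) (not-involutive (U (head E a)))
  δ⁻-complement : ∀ a → δ⁻ E (not ∘ U) a ≡ δ⁺ E U a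
  δ⁻-complement a = cong (_∧ not (U (head E a))) (not-involutive (U (tail E a)))

netOutflow≡supply : ∀ {n m s} (E : Fin m → Fin n × Fin n) (f : Arc m → ℚ) (w : Fin n)
  (r : Fin s → Fin n) → (∀ i l → r i ≡ r l → i ≡ l) → (μ : Fin s → ℚ) →
  (∀ i → r i ≢ w → netOutflow E ⟦ r i ⟧ f ≡ μ i) →
  (∀ v → v ≢ w → (∀ i → r i ≢ v) → netOutflow E ⟦ v ⟧ f ≡ 0ℚ) →
  (S : Subset n) → S w ≡ false → netOutflow E S f ≡ ∑[ i < s ] (𝟙 (S (r i)) * μ i)
netOutflow≡supply {n} {s = s} E f w r r-injective μ supply conservation S Sw≡false = begin
  netOutflow E S f                                   ≡⟨ netOutflow-decompose E S f ⟩
  ∑[ v < n ] (𝟙 (S v) * netOutflow E ⟦ v ⟧ f)        ≡⟨ ∑-over-image r r-injective _ off-terminals ⟩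
  ∑[ i < s ] (𝟙 (S (r i)) * netOutflow E ⟦ r i ⟧ f)  ≡⟨ sum-cong-≗ at-terminals ⟩
  ∑[ i < s ] (𝟙 (S (r i)) * μ i)                     ∎
  where
  open ≡-Reasoning
  off-terminals : ∀ v → (∀ i → r i ≢ v) → 𝟙 (S v) * netOutflow E ⟦ v ⟧ f ≡ 0ℚ
  off-terminals v v∉r with v ≟ w
  ... | yes refl = 𝟙-false _ Sw≡false
  ... | no v≢w   = trans (cong (𝟙 (S v) *_) (conservation v v≢w v∉r)) (*-zeroʳ (𝟙 (S v)))
  at-terminals : ∀ i → 𝟙 (S (r i)) * netOutflow E ⟦ r i ⟧ f ≡ 𝟙 (S (r i)) * μ i
  at-terminals i with r i ≟ w
  ... | yes refl = trans (𝟙-false _ Sw≡false) (sym (𝟙-false _ Sw≡false))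
  ... | no ri≢w  = cong (𝟙 (S (r i)) *_) (supply i ri≢w)

prev : ∀ {k} → ℚ → (Fin k → ℚ) → Fin k → ℚ
prev a g zero    = a
prev a g (suc i) = g (inject₁ i)

Δ : ∀ {k} → ℚ → (Fin k → ℚ) → Fin k → ℚ
Δ a g i = g i - prev a g i

IncreasingFrom : ∀ {k} → ℚ → (Fin k → ℚ) → Set
IncreasingFrom a g = ∀ i → prev a g i ≤ g i

CappedOn : ∀ {k} → (Fin k → Bool) → ℚ → ℚ → (Fin k → ℚ) → Set
CappedOn S X a g = ∀ i → S i ≡ true → g i ≤ prev a g i ⊔ X

increments : ∀ {k} → (Fin k → Bool) → ℚ → (Fin k → ℚ) → ℚ
increments {k} S a g = ∑[ i < k ] (𝟙 (S i) * Δ a g i)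

module _ {k} {a : ℚ} {g : Fin (suc k) → ℚ} where

  prev-suc : ∀ i → prev a g (suc i) ≡ prev (g zero) (g ∘ suc) i
  prev-suc zero    = refl
  prev-suc (suc i) = refl

  increasingFrom-tail : IncreasingFrom a g → IncreasingFrom (g zero) (g ∘ suc)
  increasingFrom-tail inc i = subst (_≤ g (suc i)) (prev-suc i) (inc (suc i))

  cappedOn-tail : ∀ {S X} → CappedOn S X a g → CappedOn (S ∘ suc) X (g zero) (g ∘ suc)
  cappedOn-tail {X = X} capped i Si = subst (λ p → g (suc i) ≤ p ⊔ X) (prev-suc i) (capped (suc i) Si)

  increments-suc : ∀ S → increments S a g ≡
                         𝟙 (S zero) * (g zero - a) + increments (S ∘ suc) (g zero) (g ∘ suc)
  increments-suc S = cong (𝟙 (S zero) * (g zero - a) +_)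
    (sum-cong-≗ (λ i → cong (λ p → 𝟙 (S (suc i)) * (g (suc i) - p)) (prev-suc i)))

  increments-selected-head : ∀ S → S zero ≡ true →
                             increments S a g ≡ (g zero - a) + increments (S ∘ suc) (g zero) (g ∘ suc)
  increments-selected-head S S0 = trans (increments-suc S) (cong (_+ _) (𝟙-true (g zero - a) S0))

  increments-skipped-head : ∀ S → S zero ≡ false →
                            increments S a g ≡ increments (S ∘ suc) (g zero) (g ∘ suc)
  increments-skipped-head S S0 =
    trans (increments-suc S) (trans (cong (_+ _) (𝟙-false (g zero - a) S0)) (+-identityˡ _))

Δ-nonneg : ∀ {k a} {g : Fin k → ℚ} → IncreasingFrom a g → ∀ i → 0ℚ ≤ Δ a g i
Δ-nonneg {a = a} {g} inc i = subst (_≤ Δ a g i) (+-inverseʳ (prev a g i)) (+-monoˡ-≤ (- prev a g i) (inc i))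

increments-nonneg : ∀ {k a} {g : Fin k → ℚ} (S : Fin k → Bool) → IncreasingFrom a g →
                    0ℚ ≤ increments S a g
increments-nonneg S inc = sum-nonneg (λ i → 𝟙*-nonneg (S i) (Δ-nonneg inc i))

increments-≥-prefix : ∀ {k a} {g : Fin k → ℚ} (S : Fin k → Bool) → IncreasingFrom a g →
                      (t : Fin k) → (∀ i → toℕ i N.≤ toℕ t → S i ≡ true) → g t - a ≤ increments S a g
increments-≥-prefix {suc k} {a} {g} S inc zero selected = begin
  g zero - a             ≡⟨ +-identityʳ (g zero - a) ⟨
  (g zero - a) + 0ℚ      ≤⟨ +-monoʳ-≤ (g zero - a) (increments-nonneg (S ∘ suc) (increasingFrom-tail inc)) ⟩
  (g zero - a) + rest    ≡⟨ increments-selected-head {a = a} {g} S (selected zero z≤n) ⟨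
  increments S a g       ∎
  where
  open ≤-Reasoning
  rest = increments (S ∘ suc) (g zero) (g ∘ suc)
increments-≥-prefix {suc k} {a} {g} S inc (suc t) selected = begin
  g (suc t) - a                        ≡⟨ solve 3 (λ a g₀ gₜ → gₜ :- a := (g₀ :- a) :+ (gₜ :- g₀)) refl a (g zero) (g (suc t)) ⟩
  (g zero - a) + (g (suc t) - g zero)  ≤⟨ +-monoʳ-≤ (g zero - a) tail-bound ⟩
  (g zero - a) + rest                  ≡⟨ increments-selected-head {a = a} {g} S (selected zero z≤n) ⟨
  increments S a g                     ∎
  where
  open ≤-Reasoning
  rest = increments (S ∘ suc) (g zero) (g ∘ suc)
  tail-bound : g (suc t) - g zero ≤ rest
  tail-bound = increments-≥-prefix (S ∘ suc) (increasingFrom-tail inc) t (λ i → selected (suc i) ∘ s≤s)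

capped-step : ∀ {a b X} c → a ≤ b → (c ≡ true → b ≤ a ⊔ X) → (a ⊓ X) + 𝟙 c * (b - a) ≤ b ⊓ X
capped-step {a} {b} {X} true  a≤b capped =
  ≤-reflexive (trans (cong ((a ⊓ X) +_) (*-identityˡ (b - a))) (⊓-step a≤b (capped refl)))
capped-step {a} {b} {X} false a≤b _      = begin
  (a ⊓ X) + 0ℚ * (b - a)  ≡⟨ cong ((a ⊓ X) +_) (*-zeroˡ (b - a)) ⟩
  (a ⊓ X) + 0ℚ            ≡⟨ +-identityʳ (a ⊓ X) ⟩
  a ⊓ X                   ≤⟨ ⊓-monoˡ-≤ X a≤b ⟩
  b ⊓ X                   ∎
  where open ≤-Reasoning

increments-capped : ∀ {k a X} {g : Fin k → ℚ} (S : Fin k → Bool) → IncreasingFrom a g → CappedOn S X a g →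
                    (a ⊓ X) + increments S a g ≤ X
increments-capped {zero} {a} {X} S _ _ = begin
  (a ⊓ X) + 0ℚ                                                     ≡⟨ +-identityʳ (a ⊓ X) ⟩
  a ⊓ X                                                            ≤⟨ p⊓q≤q a X ⟩
  X                                                                ∎
  where open ≤-Reasoning
increments-capped {suc k} {a} {X} {g} S inc capped = begin
  (a ⊓ X) + increments S a g                    ≡⟨ cong ((a ⊓ X) +_) (increments-suc {a = a} {g} S) ⟩
  (a ⊓ X) + (𝟙 (S zero) * (g zero - a) + rest)  ≡⟨ +-assoc (a ⊓ X) _ rest ⟨
  (a ⊓ X) + 𝟙 (S zero) * (g zero - a) + rest    ≤⟨ +-monoˡ-≤ rest (capped-step (S zero) (inc zero) (capped zero)) ⟩
  (g zero ⊓ X) + rest                           ≤⟨ increments-capped (S ∘ suc) (increasingFrom-tail inc) (cappedOn-tail capped) ⟩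
  X                                             ∎
  where
  open ≤-Reasoning
  rest = increments (S ∘ suc) (g zero) (g ∘ suc)

increments-capped-after : ∀ {k a X} {g : Fin k → ℚ} (S : Fin k → Bool) → IncreasingFrom a g → CappedOn S X a g →
                          (t : Fin k) → (∀ i → toℕ i N.≤ toℕ t → S i ≡ false) →
                          (g t ⊓ X) + increments S a g ≤ X
increments-capped-after {suc k} {a} {X} {g} S inc capped t unselected = begin
  (g t ⊓ X) + increments S a g  ≡⟨ cong ((g t ⊓ X) +_) (increments-skipped-head {a = a} {g} S (unselected zero z≤n)) ⟩
  (g t ⊓ X) + rest              ≤⟨ from-tail t unselected ⟩
  X                             ∎
  where
  open ≤-Reasoning
  rest = increments (S ∘ suc) (g zero) (g ∘ suc)
  from-tail : ∀ t → (∀ i → toℕ i N.≤ toℕ t → S i ≡ false) → (g t ⊓ X) + rest ≤ X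
  from-tail zero    _          = increments-capped (S ∘ suc) (increasingFrom-tail inc) (cappedOn-tail capped)
  from-tail (suc t) unselected = increments-capped-after (S ∘ suc) (increasingFrom-tail inc) (cappedOn-tail capped)
                                   t (λ i → unselected (suc i) ∘ s≤s)

_∈ₚ_ : ∀ {n} → Fin n → Fin n × Fin n → Set
v ∈ₚ P = v ≡ proj₁ P ⊎ v ≡ proj₂ P

meets-intro : ∀ {n} {P : Fin n × Fin n} {U : Subset n} {v} → U v ≡ true → v ∈ₚ P → meets P U ≡ true
meets-intro {P = v , w} {U} Uv (inj₁ refl) = cong (_∨ U w) Uv
meets-intro {P = u , v} {U}  Uv (inj₂ refl) = trans (cong (U u ∨_) Uv) (∨-zeroʳ (U u))

meets-elim : ∀ {n} (P : Fin n × Fin n) (U : Subset n) → meets P U ≡ true →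
             ∃ λ v → U v ≡ true × v ∈ₚ P
meets-elim (u , v) U meet with U u in Uu
... | true  = u , Uu , inj₁ refl
... | false = v , meet , inj₂ refl

anyFin-intro : ∀ {k} (b : Fin k → Bool) (l : Fin k) → b l ≡ true → anyFin b ≡ true
anyFin-intro b zero    bl = cong (_∨ anyFin (b ∘ suc)) bl
anyFin-intro b (suc l) bl = trans (cong (b zero ∨_) (anyFin-intro (b ∘ suc) l bl)) (∨-zeroʳ (b zero))

anyFin-elim : ∀ {k} (b : Fin k → Bool) → anyFin b ≡ true → ∃ λ l → b l ≡ true
anyFin-elim {suc k} b any with b zero in b0
... | true  = zero , b0
... | false = let l , bl = anyFin-elim (b ∘ suc) any in suc l , bl

prefixSet-intro : ∀ {n s} (r : Fin s → Fin n) {i l : Fin s} → toℕ l N.≤ toℕ i → prefixSet r i (r l) ≡ true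
prefixSet-intro r {i} {l} l≤i =
  anyFin-intro _ l (cong₂ _∧_ (Equivalence.to T-≡ (NP.≤⇒≤ᵇ l≤i)) (==-true refl))

prefixSet-elim : ∀ {n s} (r : Fin s → Fin n) {i : Fin s} {v} → prefixSet r i v ≡ true →
                 ∃ λ l → toℕ l N.≤ toℕ i × r l ≡ v
prefixSet-elim r {i} {v} v∈prefix with anyFin-elim _ v∈prefix
... | l , found with toℕ l N.≤ᵇ toℕ i in l≤ᵇi | r l == v in rl==v
...   | true | true = l , NP.≤ᵇ⇒≤ (toℕ l) (toℕ i) (Equivalence.from T-≡ l≤ᵇi) , ==-sound rl==v

maxFin-ub : ∀ {k} (b : Fin k → Bool) (g : Fin k → ℚ) {q} → b q ≡ true → g q ≤ maxFin b g
maxFin-ub b g {zero}  bq rewrite bq = p≤p⊔q (g zero) (maxFin (b ∘ suc) (g ∘ suc))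
maxFin-ub b g {suc q} bq = ≤-trans (maxFin-ub (b ∘ suc) (g ∘ suc) bq) (p≤q⊔p (if b zero then g zero else 0ℚ) _)

maxFin-nonneg : ∀ {k} (b : Fin k → Bool) (g : Fin k → ℚ) → 0ℚ ≤ maxFin b g
maxFin-nonneg {zero}  b g = ≤-refl
maxFin-nonneg {suc k} b g = ≤-trans (maxFin-nonneg (b ∘ suc) (g ∘ suc)) (p≤q⊔p (if b zero then g zero else 0ℚ) _)

maxFin-lub : ∀ {k} (b : Fin k → Bool) (g : Fin k → ℚ) {B} → 0ℚ ≤ B → (∀ q → b q ≡ true → g q ≤ B) →
             maxFin b g ≤ B
maxFin-lub {zero}  b g B≥0 _      = B≥0
maxFin-lub {suc k} b g B≥0 bounded = ⊔-lub first (maxFin-lub (b ∘ suc) (g ∘ suc) B≥0 (bounded ∘ suc))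
  where
  first : (if b zero then g zero else 0ℚ) ≤ _
  first with b zero in b0
  ... | true  = bounded zero b0
  ... | false = B≥0

module _ {n p s} (𝒫 : Fin p → Fin n × Fin n) (z : Fin p → Fin n → ℚ) (r : Fin s → Fin n) (w : Fin n) where

  lam-nonneg : ∀ i → 0ℚ ≤ lam 𝒫 z r w i
  lam-nonneg i = maxFin-nonneg (λ q → meets (𝒫 q) (prefixSet r i)) (λ q → z q w)

  lam-ub : ∀ {i l} q → toℕ l N.≤ toℕ i → r l ∈ₚ 𝒫 q → z q w ≤ lam 𝒫 z r w i
  lam-ub {i} q l≤i rl∈q = maxFin-ub (λ q → meets (𝒫 q) (prefixSet r i)) (λ q → z q w)
                                     (meets-intro {U = prefixSet r i} (prefixSet-intro r l≤i) rl∈q)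

  lam-lub : ∀ i {B} → 0ℚ ≤ B → (∀ q l → toℕ l N.≤ toℕ i → r l ∈ₚ 𝒫 q → z q w ≤ B) → lam 𝒫 z r w i ≤ B
  lam-lub i B≥0 bounded = maxFin-lub (λ q → meets (𝒫 q) (prefixSet r i)) (λ q → z q w) B≥0 λ q meet →
    let v , v∈prefix , v∈q = meets-elim (𝒫 q) (prefixSet r i) meet
        l , l≤i , rl≡v     = prefixSet-elim r v∈prefix
    in  bounded q l l≤i (subst (_∈ₚ 𝒫 q) (sym rl≡v) v∈q)

  lam-mono : ∀ {i i′} → toℕ i N.≤ toℕ i′ → lam 𝒫 z r w i ≤ lam 𝒫 z r w i′
  lam-mono {i} {i′} i≤i′ = lam-lub i (lam-nonneg i′) (λ q l l≤i → lam-ub q (NP.≤-trans l≤i i≤i′))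

  lam-increasing : IncreasingFrom 0ℚ (lam 𝒫 z r w)
  lam-increasing zero    = lam-nonneg zero
  lam-increasing (suc i) = lam-mono (NP.<⇒≤ (≤-inject₁⇒<-suc i NP.≤-refl))

  lam-capped : ∀ (U : Subset n) X → (∀ q → meets (𝒫 q) U ≡ true → z q w ≤ X) →
               CappedOn (U ∘ r) X 0ℚ (lam 𝒫 z r w)
  lam-capped U X U-bounded i U-ri = lam-lub i (≤-trans (prev-nonneg i) (p≤p⊔q _ X)) bound
    where
    prev-nonneg : ∀ i → 0ℚ ≤ prev 0ℚ (lam 𝒫 z r w) i
    prev-nonneg zero    = ≤-refl
    prev-nonneg (suc i) = lam-nonneg (inject₁ i)
    earlier : ∀ {i l} q → toℕ l N.< toℕ i → r l ∈ₚ 𝒫 q → z q w ≤ prev 0ℚ (lam 𝒫 z r w) i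
    earlier {suc i} q l<i = lam-ub q (<-suc⇒≤-inject₁ i l<i)
    bound : ∀ q l → toℕ l N.≤ toℕ i → r l ∈ₚ 𝒫 q → z q w ≤ prev 0ℚ (lam 𝒫 z r w) i ⊔ X
    bound q l l≤i rl∈q with NP.m≤n⇒m<n∨m≡n l≤i
    ... | inj₁ l<i = ≤-trans (earlier q l<i rl∈q) (p≤p⊔q _ X)
    ... | inj₂ l≡i rewrite toℕ-injective l≡i =
      ≤-trans (U-bounded q (meets-intro {U = U} U-ri rl∈q)) (p≤q⊔p (prev 0ℚ (lam 𝒫 z r w) i) X)

mu≡Δ : ∀ {n p s} (𝒫 : Fin p → Fin n × Fin n) (z : Fin p → Fin n → ℚ) (r : Fin (suc s) → Fin n) (w : Fin n) →
       ∀ i → mu 𝒫 z r w i ≡ Δ 0ℚ (lam 𝒫 z r w) i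
mu≡Δ 𝒫 z r w zero    = sym (+-identityʳ (lam 𝒫 z r w zero))
mu≡Δ 𝒫 z r w (suc i) = refl

arc-endpoints : ∀ {n} {P : Fin n × Fin n} {u v} → (P ≡ (u , v)) ⊎ (P ≡ (v , u)) → u ∈ₚ P × v ∈ₚ P
arc-endpoints (inj₁ refl) = inj₁ refl , inj₂ refl
arc-endpoints (inj₂ refl) = inj₂ refl , inj₁ refl

lemma14 :
  (n m p k : ℕ)
  -- the graph G = (Fin n, Fin m) with costs c ≥ 0
  (E : Fin m → Fin n × Fin n)
  (c : Fin m → ℚ) → (∀ e → 0ℚ ≤ c e) →
  -- the demand pairs, each a 2-element set {proj₁ P, proj₂ P}
  (𝒫 : Fin p → Fin n × Fin n) → (∀ q → proj₁ (𝒫 q) ≢ proj₂ (𝒫 q)) →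
  -- R = {r_0, …, r_{k+1}} (|R| ≥ 2), numbered injectively
  (r : Fin (suc (suc k)) → Fin n) → (∀ i l → r i ≡ r l → i ≡ l) →
  -- every demand pair lies in R (R is the only nontrivial component)
  (∀ q → (∃ λ i → r i ≡ proj₁ (𝒫 q)) × (∃ λ i → r i ≡ proj₂ (𝒫 q))) →
  -- the arborescence (R, A): the unique arc entering r_{suc j} is
  -- (r_{parent j}, r_{suc j}), with parent j < suc j, and it is the
  -- demand pair arcPair j
  (parent : Fin (suc k) → Fin (suc (suc k))) →
  (∀ j → toℕ (parent j) N.< toℕ (suc j)) →
  (arcPair : Fin (suc k) → Fin p) →
  (∀ j → (𝒫 (arcPair j) ≡ (r (parent j) , r (suc j)))
       ⊎ (𝒫 (arcPair j) ≡ (r (suc j) , r (parent j)))) →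
  -- a feasible solution (x, z) of Forest-BCR
  (x : Fin n → Arc m → ℚ) (z : Fin p → Fin n → ℚ) →
  (∀ v a → 0ℚ ≤ x v a) → (∀ q v → 0ℚ ≤ z q v) →
  (∀ q → sumFin (λ v → z q v) ≡ 1ℚ) →
  (∀ v q (U : Subset n) → U v ≡ false → meets (𝒫 q) U ≡ true →
     z q v ≤ outSum E U (x v)) →
  -- w and the flow f = f^w
  (w : Fin n) (f : Arc m → ℚ) →
  (∀ a → 0ℚ ≤ f a) → (∀ a → f a ≤ x w a) →
  (∀ i → r i ≢ w →
     outSum E ⟦ r i ⟧ f - inSum E ⟦ r i ⟧ f ≡ mu 𝒫 z r w i) →
  (∀ v → v ≢ w → (∀ i → r i ≢ v) →
     outSum E ⟦ v ⟧ f - inSum E ⟦ v ⟧ f ≡ 0ℚ) →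
  -- U ⊆ V ∖ {r_0}, and r_{suc j} is the first r_i in U
  (U : Subset n) → U (r zero) ≡ false →
  (j : Fin (suc k)) → U (r (suc j)) ≡ true →
  (∀ l → toℕ l N.< toℕ (suc j) → U (r l) ≡ false) →
  z (arcPair j) w ≤ outSum E U (xbar (x w) f)
lemma14 n m p k E _ _ 𝒫 _ r r-injective _ parent parent<child arcPair arcPair-ends x z x≥0 _ _ feasible
        w f _ _ supply conservation U _ j child∈U before-child = by-root (U w) refl
  where
  Λ = lam 𝒫 z r w
  X = outSum E U (x w)
  t = inject₁ j

  ends : r (parent j) ∈ₚ 𝒫 (arcPair j) × r (suc j) ∈ₚ 𝒫 (arcPair j)
  ends = arc-endpoints (arcPair-ends j)

  zP≤Λt : z (arcPair j) w ≤ Λ t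
  zP≤Λt = lam-ub 𝒫 z r w (arcPair j) (<-suc⇒≤-inject₁ j (parent<child j)) (proj₁ ends)

  supplied : ∀ S → S w ≡ false → netOutflow E S f ≡ increments (S ∘ r) 0ℚ Λ
  supplied = netOutflow≡supply E f w r r-injective (Δ 0ℚ Λ)
               (λ i ri≢w → trans (supply i ri≢w) (mu≡Δ 𝒫 z r w i)) conservation

  before : ∀ i → toℕ i N.≤ toℕ t → U (r i) ≡ false
  before i i≤t = before-child i (≤-inject₁⇒<-suc j i≤t)

  by-root : ∀ b → U w ≡ b → z (arcPair j) w ≤ outSum E U (xbar (x w) f)
  by-root false Uw = begin
    z (arcPair j) w                    ≤⟨ ⊓-glb zP≤Λt (feasible w _ U Uw (meets-intro {U = U} child∈U (proj₂ ends))) ⟩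
    Λ t ⊓ X                            ≤⟨ p+q≤r⇒p≤r-q (increments-capped-after (U ∘ r) (lam-increasing 𝒫 z r w)
                                                         (lam-capped 𝒫 z r w U X (λ q → feasible w q U Uw)) t before) ⟩
    X - increments (U ∘ r) 0ℚ Λ        ≡⟨ cong (λ s → X - s) (supplied U Uw) ⟨
    X - netOutflow E U f               ≡⟨ outSum-xbar E U (x w) f ⟨
    outSum E U (xbar (x w) f)          ∎
    where open ≤-Reasoning
  by-root true Uw = begin
    z (arcPair j) w                    ≤⟨ zP≤Λt ⟩
    Λ t                                ≡⟨ +-identityʳ (Λ t) ⟨
    Λ t - 0ℚ                           ≤⟨ increments-≥-prefix (not ∘ U ∘ r) (lam-increasing 𝒫 z r w) t
                                                               (λ i → cong not ∘ before i) ⟩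
    increments (not ∘ U ∘ r) 0ℚ Λ      ≤⟨ 0≤p⇒q≤p+q _ (sumArcs-nonneg (δ⁺ E U) (x≥0 w)) ⟩
    X + increments (not ∘ U ∘ r) 0ℚ Λ  ≡⟨ cong (X +_) (supplied (not ∘ U) (cong not Uw)) ⟨
    X + netOutflow E (not ∘ U) f       ≡⟨ cong (X +_) (netOutflow-complement E U f) ⟩
    X - netOutflow E U f               ≡⟨ outSum-xbar E U (x w) f ⟨
    outSum E U (xbar (x w) f)          ∎
    where open ≤-Reasoning
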